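{- Let $R$ be a vertex color class of a CCD $G$ and let $H_1,H_2$ be ultrahomogeneous CCDs. Suppose $Y_1=G[H_1\to_{\tau_1}R]$ and $Y_2=G[H_2\to_{\tau_2}R]$ are easygoing blow-ups. Then $Y_1$ is ultrahomogeneous if and only if $Y_2$ is ultrahomogeneous. In particular, if $G[R]$ is ultrahomogeneous, then $Y_2$ is ultrahomogeneous if and only if $G$ is ultrahomogeneous.
   Context: A complete colored digraph (CCD) $G$ consists of a finite non-empty vertex set $V(G)$, a vertex coloring $\chi_G$ and an edge coloring $\zeta_G$ on all ordered pairs of distinct vertices; $G[U]$ is the induced CCD. Isomorphisms preserve both colorings; a partial isomorphism is an isomorphism between induced sub-CCDs; $G$ is ultrahomogeneous if every partial isomorphism extends to an automorphism. A vertex color class is a maximal set of vertices of one color. A block system of $\mathrm{Aut}(H)$ is a partition of $V(H)$ mapped to itself by all automorphisms; $\mathrm{Aut}(H)^{\mathcal B}$ is the induced group on blocks. A permutational isomorphism from $\Gamma\le\mathrm{Sym}(V)$ to $\Gamma'\le\mathrm{Sym}(V')$ is a bijection $\rho:V\to V'$ with $\Gamma'=\{\rho\gamma\rho^{ -1}:\gamma\in\Gamma\}$. Blow-up: let $R$ be a vertex color class of $G$, $H$ a CCD all of whose vertices have the same color, $\mathcal B$ a block system of $\mathrm{Aut}(H)$ and $\tau:\mathcal B\to R$ a permutational isomorphism from $\mathrm{Aut}(H)^{\mathcal B}$ to $\mathrm{Aut}(G[R])$. Put $\hat\tau(v)=\tau(B)$ for $v\in B\in\mathcal B$ and $\hat\tau(v)=v$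 for $v\in V(G)\setminus R$. The blow-up $G[H\to_\tau R]$ is the CCD on $(V(G)\setminus R)\sqcup V(H)$ with vertex colors $\chi_G(\hat\tau(v))$ and edge colors $\zeta_H((v,v'))$ if $v,v'\in V(H)$ and $\zeta_G((\hat\tau(v),\hat\tau(v')))$ otherwise. It is easygoing if $H$ is easygoing with respect to $\mathcal B$, i.e., for every $\mathcal B'\subseteq\mathcal B$ the group induced on $\mathcal B$ by the pointwise stabilizer in $\mathrm{Aut}(H)$ of $\bigcup_{X\in\mathcal B'}X$ equals the subgroup of $\mathrm{Aut}(H)^{\mathcal B}$ fixing every block in $\mathcal B'$. -}

module Defs where

open import Data.Nat using (ℕ; suc; _≡ᵇ_)
open import Data.Bool using (Bool; true; false)
open import Data.Fin using (Fin)
open import Data.Product using (Σ; ∃; _×_; _,_; proj₁; proj₂)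
open import Data.Sum using (_⊎_; inj₁; inj₂)
open import Function.Bundles using (_↔_; _⇔_)
open import Function.Definitions using (Bijective; Surjective)
open import Relation.Binary.PropositionalEquality using (_≡_; _≢_)

-- A "raw" CCD is the
-- coloring data without the finiteness requirement; a CCD adds
-- finiteness and non-emptiness of the vertex set.
-- Edge colors are given on all ordered pairs, but only the values on
-- pairs of DISTINCT vertices are ever used.

record RawCCD : Set₁ where
  field
    V    : Set
    vcol : V → ℕ
    ecol : V → V → ℕ
open RawCCD public

record CCD : Set₁ where
  field
    raw  : RawCCD
    size : ℕ
    enum : V raw ↔ Fin (suc size)
open CCD public

IsIso : (X Y : RawCCD) → (V X → V Y) → Set
IsIso X Y f =
  Bijective _≡_ _≡_ f
  × (∀ x → vcol Y (f x) ≡ vcol X x)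
  × (∀ x y → x ≢ y → ecol Y (f x) (f y) ≡ ecol X x y)

IsAut : (X : RawCCD) → (V X → V X) → Set
IsAut X f = IsIso X X f

Sub : (X : RawCCD) → (V X → Bool) → Set
Sub X U = Σ (V X) (λ v → U v ≡ true)

induced : (X : RawCCD) → (V X → Bool) → RawCCD
induced X U = record
  { V = Sub X U
  ; vcol = λ u → vcol X (proj₁ u)
  ; ecol = λ u w → ecol X (proj₁ u) (proj₁ w) }

Ultrahomogeneous : RawCCD → Set
Ultrahomogeneous X =
  (U U' : V X → Bool) (f : Sub X U → Sub X U') →
  IsIso (induced X U) (induced X U') f →
  ∃ λ (σ : V X → V X) → IsAut X σ × (∀ u → σ (proj₁ u) ≡ proj₁ (f u))

-- c is the color of the vertex color class R = {v | χ v = c}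
IsColorClass : CCD → ℕ → Set
IsColorClass G c = ∃ λ v → vcol (raw G) v ≡ c

ClassV : CCD → ℕ → Set
ClassV G c = Σ (V (raw G)) (λ v → vcol (raw G) v ≡ c)

inducedClass : (G : CCD) → ℕ → RawCCD
inducedClass G c = record
  { V = ClassV G c
  ; vcol = λ u → vcol (raw G) (proj₁ u)
  ; ecol = λ u w → ecol (raw G) (proj₁ u) (proj₁ w) }

OutV : CCD → ℕ → Set
OutV G c = Σ (V (raw G)) (λ v → (vcol (raw G) v ≡ᵇ c) ≡ false)

-- Block systems and induced action on blocks.  A partition of V(H) is
-- given by a block type B and a surjection blk : V(H) → B (v ∈ X iff
-- blk v ≡ X).

InducedBy : {VH B : Set} → (VH → B) → (VH → VH) → (B → B) → Set
InducedBy {VH} blk σ π = ∀ (v : VH) → π (blk v) ≡ blk (σ v)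

InAutBlocks : (H : CCD) {B : Set} → (V (raw H) → B) → (B → B) → Set
InAutBlocks H blk π = ∃ λ σ → IsAut (raw H) σ × InducedBy blk σ π

IsBlockSystem : (H : CCD) {B : Set} → (V (raw H) → B) → Set
IsBlockSystem H blk =
  Surjective _≡_ _≡_ blk
  × (∀ σ → IsAut (raw H) σ → ∀ u v → blk u ≡ blk v → blk (σ u) ≡ blk (σ v))

record BlowUpData (G : CCD) (c : ℕ) (H : CCD) : Set₁ where
  field
    monochrome : ∀ u v → vcol (raw H) u ≡ vcol (raw H) v
    B          : Set
    blk        : V (raw H) → B
    blockSys   : IsBlockSystem H blk
    τ          : B → ClassV G c
    τ-bij      : Bijective _≡_ _≡_ τ
    -- Aut(G[R]) = { τ γ τ⁻¹ | γ ∈ Aut(H)^B }, as sets of maps R → R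
    permIso    : ∀ (ψ : ClassV G c → ClassV G c) →
                 (IsAut (inducedClass G c) ψ ⇔
                  (∃ λ π → InAutBlocks H blk π × (∀ X → ψ (τ X) ≡ τ (π X))))
  τ̂ : OutV G c ⊎ V (raw H) → V (raw G)
  τ̂ (inj₁ v) = proj₁ v
  τ̂ (inj₂ h) = proj₁ (τ (blk h))
open BlowUpData public

-- the blow-up G[H →_τ R] (as colored structure; it is finite and
-- non-empty whenever G and H are)
blowUp : {G : CCD} {c : ℕ} {H : CCD} → BlowUpData G c H → RawCCD
blowUp {G} {c} {H} D = record
  { V = OutV G c ⊎ V (raw H)
  ; vcol = λ v → vcol (raw G) (τ̂ D v)
  ; ecol = ec }
  where
  ec : OutV G c ⊎ V (raw H) → OutV G c ⊎ V (raw H) → ℕ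
  ec (inj₂ h) (inj₂ h') = ecol (raw H) h h'
  ec v w = ecol (raw G) (τ̂ D v) (τ̂ D w)

Easygoing : {G : CCD} {c : ℕ} {H : CCD} → BlowUpData G c H → Set
Easygoing {G} {c} {H} D =
  ∀ (B' : B D → Bool) (π : B D → B D) →
    (∃ λ σ → IsAut (raw H) σ
           × (∀ v → B' (blk D v) ≡ true → σ v ≡ v)
           × InducedBy (blk D) σ π)
    ⇔ (InAutBlocks H (blk D) π × (∀ X → B' X ≡ true → π X ≡ X))

-- Both blow-ups, and G itself when G[R] is ultrahomogeneous, are ultrahomogeneous exactly when
-- G is class-ultrahomogeneous: every partial isomorphism f of G that agrees on R with some
-- automorphism ψ of G[R] extends to an automorphism of G.  Everything is transported along the
-- blow-down map τ̂ : Y → G collapsing each block of H to its vertex of R; through τ, automorphisms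
-- of H induce automorphisms of G[R], and every automorphism of G[R] is induced this way.
-- If Y is ultrahomogeneous, lift f to Y using an automorphism of H covering ψ, extend it there
-- and push the extension down to G.  Conversely, a partial isomorphism of Y restricts on H to one
-- that extends to some β ∈ Aut H, and then descends to a partial isomorphism of G compatible with
-- the automorphism induced by β.  Its extension σ lifts back to Y through an automorphism of H
-- covering σ on R, and easygoingness allows choosing that automorphism to agree with β on the
-- domain of the original map.
{-# OPTIONS --safe #-}
module Submission where

open import Defs
open import Axiom.UniquenessOfIdentityProofs.WithK using (uip)
open import Data.Bool using (Bool; true; false; T)
open import Data.Bool.Properties using () renaming (_≟_ to _≟ᵇ_)
open import Data.Empty using (⊥; ⊥-elim)
open import Data.Fin using (Fin)
open import Data.Fin.Properties using (any?) renaming (_≟_ to _≟ᶠ_)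
open import Data.Nat using (ℕ; _≡ᵇ_)
open import Data.Nat.Properties using (≡ᵇ⇒≡; ≡⇒≡ᵇ)
open import Data.Product using (Σ; ∃; _×_; _,_; proj₁; proj₂)
open import Data.Sum using (_⊎_; inj₁; inj₂)
import Data.Sum as Sum
open import Data.Sum.Properties using (inj₂-injective)
open import Data.Unit using (tt)
open import Function using (_∘_; _↔_; Inverse; Equivalence; _⇔_; mk⇔)
import Function.Properties.Equivalence as ⇔
open import Function.Properties.Inverse using (↔⇒↣)
open import Relation.Binary.Definitions using (DecidableEquality)
open import Relation.Binary.PropositionalEquality
open import Relation.Nullary using (Dec; yes; no; does)
open import Relation.Nullary.Decidable using (map′; _×-dec_; _⊎-dec_; via-injection)
open import Relation.Unary using (Decidable)

open ≡-Reasoning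

proj₁-injective : {A B : Set} {P : A → B} {b : B} {x y : Σ A (λ a → P a ≡ b)} →
                  proj₁ x ≡ proj₁ y → x ≡ y
proj₁-injective {x = a , p} {y = .a , q} refl = cong (a ,_) (uip p q)

true⇒witness : {A : Set} (a? : Dec A) → does a? ≡ true → A
true⇒witness (yes a) _ = a
true⇒witness (no _) ()

witness⇒true : {A : Set} (a? : Dec A) → A → does a? ≡ true
witness⇒true (yes _) _ = refl
witness⇒true (no ¬a) a = ⊥-elim (¬a a)

∃-finite? : {A : Set} {n : ℕ} {P : A → Set} → A ↔ Fin n → Decidable P → Dec (∃ P)
∃-finite? {P = P} e P? =
  map′ (λ (i , p) → from i , p)
       (λ (a , p) → to a , subst P (sym (strictlyInverseʳ a)) p)
       (any? (P? ∘ from))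
  where open Inverse e

≡-finite? : {A : Set} {n : ℕ} → A ↔ Fin n → DecidableEquality A
≡-finite? e = via-injection (↔⇒↣ e) _≟ᶠ_

record _≅_ (X Y : RawCCD) : Set where
  field
    to      : V X → V Y
    from    : V Y → V X
    from∘to : ∀ x → from (to x) ≡ x
    to∘from : ∀ y → to (from y) ≡ y
    to-vcol : ∀ x → vcol Y (to x) ≡ vcol X x
    to-ecol : ∀ x x' → x ≢ x' → ecol Y (to x) (to x') ≡ ecol X x x'

  to-injective : ∀ {x x'} → to x ≡ to x' → x ≡ x'
  to-injective {x} {x'} e = trans (sym (from∘to x)) (trans (cong from e) (from∘to x'))

open _≅_ public

Aut : RawCCD → Set
Aut X = X ≅ X

module _ {X Y : RawCCD} where

  fromIsIso : {f : V X → V Y} → IsIso X Y f → X ≅ Y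
  fromIsIso {f} ((f-injective , f-surjective) , f-vcol , f-ecol) = record
    { to      = f
    ; from    = λ y → proj₁ (f-surjective y)
    ; from∘to = λ x → f-injective (proj₂ (f-surjective (f x)) refl)
    ; to∘from = λ y → proj₂ (f-surjective y) refl
    ; to-vcol = f-vcol
    ; to-ecol = f-ecol
    }

  isIso : (i : X ≅ Y) → IsIso X Y (to i)
  isIso i = (to-injective i , λ y → from i y , λ { refl → to∘from i y }) , to-vcol i , to-ecol i

  ≅-sym : X ≅ Y → Y ≅ X
  ≅-sym i = record
    { to      = from i
    ; from    = to i
    ; from∘to = to∘from i
    ; to∘from = from∘to i
    ; to-vcol = λ y → trans (sym (to-vcol i (from i y))) (cong (vcol Y) (to∘from i y))
    ; to-ecol = λ y y' y≢y' →
        trans (sym (to-ecol i (from i y) (from i y') (y≢y' ∘ from-injective)))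
              (cong₂ (ecol Y) (to∘from i y) (to∘from i y'))
    }
    where
    from-injective : ∀ {y y'} → from i y ≡ from i y' → y ≡ y'
    from-injective {y} {y'} e = trans (sym (to∘from i y)) (trans (cong (to i) e) (to∘from i y'))

≅-trans : {X Y Z : RawCCD} → X ≅ Y → Y ≅ Z → X ≅ Z
≅-trans i j = record
  { to      = to j ∘ to i
  ; from    = from i ∘ from j
  ; from∘to = λ x → trans (cong (from i) (from∘to j (to i x))) (from∘to i x)
  ; to∘from = λ z → trans (cong (to j) (to∘from i (from j z))) (to∘from j z)
  ; to-vcol = λ x → trans (to-vcol j (to i x)) (to-vcol i x)
  ; to-ecol = λ x x' x≢x' → trans (to-ecol j _ _ (x≢x' ∘ to-injective i)) (to-ecol i x x' x≢x')
  }

full : {A : Set} → A → Bool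
full _ = true

module _ {X : RawCCD} where

  Extends : {U U' : V X → Bool} → (V X → V X) → induced X U ≅ induced X U' → Set
  Extends σ f = ∀ u → σ (proj₁ u) ≡ proj₁ (to f u)

  extends-sym : {U U' : V X → Bool} {f : induced X U ≅ induced X U'} (σ : Aut X) →
                Extends (to σ) f → Extends (from σ) (≅-sym f)
  extends-sym {f = f} σ σ-extends u' = begin
    from σ (proj₁ u')                 ≡⟨ cong (from σ ∘ proj₁) (sym (to∘from f u')) ⟩
    from σ (proj₁ (to f (from f u'))) ≡⟨ cong (from σ) (sym (σ-extends (from f u'))) ⟩
    from σ (to σ (proj₁ (from f u'))) ≡⟨ from∘to σ _ ⟩
    proj₁ (from f u')                 ∎

  extend : Ultrahomogeneous X → {U U' : V X → Bool} (f : induced X U ≅ induced X U') →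
           Σ (Aut X) λ σ → Extends (to σ) f
  extend uh {U} {U'} f = let (σ , σ-aut , σ-extends) = uh U U' (to f) (isIso f) in
    fromIsIso σ-aut , σ-extends

  ultrahomogeneous : (∀ {U U'} (f : induced X U ≅ induced X U') → Σ (Aut X) λ σ → Extends (to σ) f) →
                     Ultrahomogeneous X
  ultrahomogeneous ext U U' f f-iso = let (σ , σ-extends) = ext (fromIsIso f-iso) in
    to σ , isIso σ , σ-extends

  Aut⇒full : Aut X → induced X full ≅ induced X full
  Aut⇒full σ = record
    { to      = λ (x , _) → to σ x , refl
    ; from    = λ (x , _) → from σ x , refl
    ; from∘to = λ (x , _) → proj₁-injective (from∘to σ x)
    ; to∘from = λ (x , _) → proj₁-injective (to∘from σ x)
    ; to-vcol = λ (x , _) → to-vcol σ x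
    ; to-ecol = λ (x , _) (x' , _) x≢x' → to-ecol σ x x' (x≢x' ∘ proj₁-injective)
    }

  module _ {U U' : V X → Bool} (U-full : ∀ x → U x ≡ true) (U'-full : ∀ x → U' x ≡ true) where

    full⇒Aut : induced X U ≅ induced X U' → Aut X
    full⇒Aut f = record
      { to      = λ x → proj₁ (to f (x , U-full x))
      ; from    = λ x → proj₁ (from f (x , U'-full x))
      ; from∘to = λ x → cong proj₁ (trans (cong (from f) (proj₁-injective refl)) (from∘to f _))
      ; to∘from = λ x → cong proj₁ (trans (cong (to f) (proj₁-injective refl)) (to∘from f _))
      ; to-vcol = λ x → to-vcol f _
      ; to-ecol = λ x x' x≢x' → to-ecol f _ _ (x≢x' ∘ cong proj₁)
      }

    full⇒Aut-extends : (f : induced X U ≅ induced X U') → Extends (to (full⇒Aut f)) f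
    full⇒Aut-extends f u = cong (proj₁ ∘ to f) (proj₁-injective refl)

classPart : RawCCD → ℕ → RawCCD
classPart X c = record
  { V    = Σ (V X) (λ v → vcol X v ≡ c)
  ; vcol = vcol X ∘ proj₁
  ; ecol = λ u u' → ecol X (proj₁ u) (proj₁ u')
  }

restrictToClass : {X Y : RawCCD} {c : ℕ} → X ≅ Y → classPart X c ≅ classPart Y c
restrictToClass i = record
  { to      = λ (x , e) → to i x , trans (to-vcol i x) e
  ; from    = λ (y , e) → from i y , trans (to-vcol (≅-sym i) y) e
  ; from∘to = λ (x , _) → proj₁-injective (from∘to i x)
  ; to∘from = λ (y , _) → proj₁-injective (to∘from i y)
  ; to-vcol = λ (x , _) → to-vcol i x
  ; to-ecol = λ (x , _) (x' , _) x≢x' → to-ecol i x x' (x≢x' ∘ proj₁-injective)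
  }

classPart-induced : {X : RawCCD} {c : ℕ} {U : V X → Bool} →
                    classPart (induced X U) c ≅ induced (classPart X c) (U ∘ proj₁)
classPart-induced = record
  { to      = λ ((x , p) , e) → (x , e) , p
  ; from    = λ ((x , e) , p) → (x , p) , e
  ; from∘to = λ _ → refl
  ; to∘from = λ _ → refl
  ; to-vcol = λ _ → refl
  ; to-ecol = λ _ _ _ → refl
  }

module ColorClass (G : CCD) (c : ℕ) where

  G[R] : RawCCD
  G[R] = inducedClass G c

  class≢out : ∀ {v} → vcol (raw G) v ≡ c → (vcol (raw G) v ≡ᵇ c) ≡ false → ⊥
  class≢out e q = subst T q (≡⇒≡ᵇ _ c e)

  in-class : ∀ {v} → (vcol (raw G) v ≡ᵇ c) ≡ true → vcol (raw G) v ≡ c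
  in-class q = ≡ᵇ⇒≡ _ c (subst T (sym q) tt)

  Compatible : {U U' : V (raw G) → Bool} → induced (raw G) U ≅ induced (raw G) U' → Aut G[R] → Set
  Compatible f ψ = ∀ u (e : vcol (raw G) (proj₁ u) ≡ c) → proj₁ (to ψ (proj₁ u , e)) ≡ proj₁ (to f u)

  compatible-sym : {U U' : V (raw G) → Bool} {f : induced (raw G) U ≅ induced (raw G) U'} {ψ : Aut G[R]} →
                   Compatible f ψ → Compatible (≅-sym f) (≅-sym ψ)
  compatible-sym {f = f} {ψ} compatible u' e = cong proj₁ (begin
    from ψ (proj₁ u' , e)       ≡⟨ cong (from ψ) (sym ψu≡u') ⟩
    from ψ (to ψ (proj₁ u , e')) ≡⟨ from∘to ψ _ ⟩
    (proj₁ u , e')              ∎)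
    where
    u = from f u'
    e' = trans (to-vcol (≅-sym f) u') e
    ψu≡u' : to ψ (proj₁ u , e') ≡ (proj₁ u' , e)
    ψu≡u' = proj₁-injective (trans (compatible u e') (cong proj₁ (to∘from f u')))

  ClassUltrahomogeneous : Set
  ClassUltrahomogeneous =
    ∀ {U U'} (f : induced (raw G) U ≅ induced (raw G) U') (ψ : Aut G[R]) → Compatible f ψ →
    Σ (Aut (raw G)) λ σ → Extends (to σ) f

  ultrahomogeneous⇔classUltrahomogeneous :
    Ultrahomogeneous G[R] → Ultrahomogeneous (raw G) ⇔ ClassUltrahomogeneous
  ultrahomogeneous⇔classUltrahomogeneous uhR = mk⇔ toClass fromClass
    where
    toClass : Ultrahomogeneous (raw G) → ClassUltrahomogeneous
    toClass uh f _ _ = extend uh f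

    fromClass : ClassUltrahomogeneous → Ultrahomogeneous (raw G)
    fromClass classUH = ultrahomogeneous extendG
      where
      extendG : ∀ {U U'} (f : induced (raw G) U ≅ induced (raw G) U') →
                Σ (Aut (raw G)) λ σ → Extends (to σ) f
      extendG f = classUH f (proj₁ ψ) (λ (v , p) e → cong proj₁ (proj₂ ψ ((v , e) , p)))
        where
        ψ = extend uhR (≅-trans (≅-sym classPart-induced) (≅-trans (restrictToClass f) classPart-induced))

module BlowUp {G : CCD} {c : ℕ} {H : CCD} (D : BlowUpData G c H) where

  open ColorClass G c

  Y : RawCCD
  Y = blowUp D

  ec : V (raw G) → V (raw G) → ℕ
  ec = ecol (raw G)

  _≟G_ : DecidableEquality (V (raw G))
  _≟G_ = ≡-finite? (enum G)

  ρ : V (raw H) → ClassV G c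
  ρ h = τ D (blk D h)

  τ-injective : ∀ {X X'} → τ D X ≡ τ D X' → X ≡ X'
  τ-injective = proj₁ (τ-bij D)

  _≟B_ : DecidableEquality (B D)
  X ≟B X' = map′ (τ-injective ∘ proj₁-injective) (cong (proj₁ ∘ τ D)) (proj₁ (τ D X) ≟G proj₁ (τ D X'))

  ρ-surjective : ∀ r → ∃ λ h → ρ h ≡ r
  ρ-surjective r =
    let (X , X↦r) = proj₂ (τ-bij D) r
        (h , h↦X) = proj₁ (blockSys D) X
    in h , X↦r (h↦X refl)

  blk-preserved : (β : Aut (raw H)) {h h' : V (raw H)} → blk D h ≡ blk D h' → blk D (to β h) ≡ blk D (to β h')
  blk-preserved β = proj₂ (blockSys D) (to β) (isIso β) _ _

  ρ-preserved : (β : Aut (raw H)) {h h' : V (raw H)} → ρ h ≡ ρ h' → ρ (to β h) ≡ ρ (to β h')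
  ρ-preserved β = cong (τ D) ∘ blk-preserved β ∘ τ-injective

  blockPermutation : (β : Aut (raw H)) → Σ (B D → B D) (InducedBy (blk D) (to β))
  blockPermutation β = (λ X → blk D (to β (rep X))) , λ h → blk-preserved β (rep-blk (blk D h))
    where
    rep : B D → V (raw H)
    rep X = proj₁ (proj₁ (blockSys D) X)
    rep-blk : ∀ X → blk D (rep X) ≡ X
    rep-blk X = proj₂ (proj₁ (blockSys D) X) refl

  _Covers_ : Aut (raw H) → Aut G[R] → Set
  β Covers ψ = ρ ∘ to β ≗ to ψ ∘ ρ

  covers-sym : {β : Aut (raw H)} {ψ : Aut G[R]} → β Covers ψ → ≅-sym β Covers ≅-sym ψ
  covers-sym {β} {ψ} covers h = begin
    ρ (from β h)                   ≡⟨ sym (from∘to ψ _) ⟩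
    from ψ (to ψ (ρ (from β h)))   ≡⟨ cong (from ψ) (sym (covers (from β h))) ⟩
    from ψ (ρ (to β (from β h)))   ≡⟨ cong (from ψ ∘ ρ) (to∘from β h) ⟩
    from ψ (ρ h)                   ∎

  push : (β : Aut (raw H)) → Σ (Aut G[R]) (β Covers_)
  push β = fromIsIso ψ-aut , covers
    where
    τ⁻¹ : ClassV G c → B D
    τ⁻¹ r = proj₁ (proj₂ (τ-bij D) r)
    τ⁻¹∘τ : ∀ X → τ⁻¹ (τ D X) ≡ X
    τ⁻¹∘τ X = τ-injective (proj₂ (proj₂ (τ-bij D) (τ D X)) refl)
    π = proj₁ (blockPermutation β)
    ψ : ClassV G c → ClassV G c
    ψ r = τ D (π (τ⁻¹ r))
    ψ-aut : IsAut G[R] ψ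
    ψ-aut = Equivalence.from (permIso D ψ)
      (π , (to β , isIso β , proj₂ (blockPermutation β)) , cong (τ D ∘ π) ∘ τ⁻¹∘τ)
    covers : ∀ h → ρ (to β h) ≡ ψ (ρ h)
    covers h = cong (τ D) (trans (sym (proj₂ (blockPermutation β) h)) (cong π (sym (τ⁻¹∘τ (blk D h)))))

  pull : (ψ : Aut G[R]) → Σ (Aut (raw H)) (_Covers ψ)
  pull ψ with Equivalence.to (permIso D (to ψ)) (isIso ψ)
  ... | π , (β , β-aut , β-induces-π) , ψ∘τ≡τ∘π = fromIsIso β-aut , λ h →
    trans (cong (τ D) (sym (β-induces-π h))) (sym (ψ∘τ≡τ∘π (blk D h)))

  IsOut : V Y → Set
  IsOut y = ∃ λ o → y ≡ inj₁ o

  out-vcol : ∀ {y} → IsOut y → (vcol Y y ≡ᵇ c) ≡ false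
  out-vcol ((_ , q) , refl) = q

  vcol≢c⇒out : ∀ y → (vcol Y y ≡ᵇ c) ≡ false → IsOut y
  vcol≢c⇒out (inj₁ o) _ = o , refl
  vcol≢c⇒out (inj₂ h) q = ⊥-elim (class≢out (proj₂ (ρ h)) q)

  vcol≡c⇒inj₂ : ∀ y → vcol Y y ≡ c → ∃ λ h → y ≡ inj₂ h
  vcol≡c⇒inj₂ (inj₁ (_ , q)) e = ⊥-elim (class≢out e q)
  vcol≡c⇒inj₂ (inj₂ h) _ = h , refl

  ecol-τ̂ : ∀ y y' → IsOut y ⊎ IsOut y' → ecol Y y y' ≡ ec (τ̂ D y) (τ̂ D y')
  ecol-τ̂ (inj₁ _) _ _ = refl
  ecol-τ̂ (inj₂ _) (inj₁ _) _ = refl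
  ecol-τ̂ (inj₂ _) (inj₂ _) (inj₁ (_ , ()))
  ecol-τ̂ (inj₂ _) (inj₂ _) (inj₂ (_ , ()))

  τ̂-injective-out : ∀ {y y'} → IsOut y ⊎ IsOut y' → τ̂ D y ≡ τ̂ D y' → y ≡ y'
  τ̂-injective-out (inj₁ out) e = outˡ out e
    where
    outˡ : ∀ {y y'} → IsOut y → τ̂ D y ≡ τ̂ D y' → y ≡ y'
    outˡ {y' = inj₁ _} (_ , refl) e = cong inj₁ (proj₁-injective e)
    outˡ {y' = inj₂ h} ((_ , q) , refl) e = ⊥-elim (class≢out (trans (cong (vcol (raw G)) e) (proj₂ (ρ h))) q)
  τ̂-injective-out (inj₂ out) e = sym (τ̂-injective-out (inj₁ out) (sym e))

  out-≡ : {W : V Y → Bool} {o o' : OutV G c} {p : W (inj₁ o) ≡ true} {p' : W (inj₁ o') ≡ true} →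
          proj₁ o ≡ proj₁ o' → _≡_ {A = Sub Y W} (inj₁ o , p) (inj₁ o' , p')
  out-≡ = proj₁-injective ∘ cong inj₁ ∘ proj₁-injective

  τ̂-surjective : ∀ v → ∃ λ y → τ̂ D y ≡ v
  τ̂-surjective v with vcol (raw G) v ≡ᵇ c in q
  ... | false = inj₁ (v , q) , refl
  ... | true  = let (h , ρh≡v) = ρ-surjective (v , in-class q) in
    inj₂ h , cong proj₁ ρh≡v

  module _ {U U' : V Y → Bool} (f : induced Y U ≅ induced Y U') where

    out-preserved : ∀ y → IsOut (proj₁ y) → IsOut (proj₁ (to f y))
    out-preserved y out = vcol≢c⇒out _ (trans (cong (_≡ᵇ c) (to-vcol f y)) (out-vcol out))

    inj₂-preserved : ∀ h p → ∃ λ h' → proj₁ (to f (inj₂ h , p)) ≡ inj₂ h'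
    inj₂-preserved h p = vcol≡c⇒inj₂ _ (trans (to-vcol f (inj₂ h , p)) (proj₂ (ρ h)))

    onH : Sub (raw H) (U ∘ inj₂) → Sub (raw H) (U' ∘ inj₂)
    onH (h , p) = let (h' , e) = inj₂-preserved h p in
      h' , subst (λ y → U' y ≡ true) e (proj₂ (to f (inj₂ h , p)))

    to-onH : ∀ u → proj₁ (to f (inj₂ (proj₁ u) , proj₂ u)) ≡ inj₂ (proj₁ (onH u))
    to-onH (h , p) = proj₂ (inj₂-preserved h p)

    ecol-out-preserved : ∀ y y' → IsOut (proj₁ y) ⊎ IsOut (proj₁ y') → τ̂ D (proj₁ y) ≢ τ̂ D (proj₁ y') →
                         ec (τ̂ D (proj₁ (to f y))) (τ̂ D (proj₁ (to f y')))
                           ≡ ec (τ̂ D (proj₁ y)) (τ̂ D (proj₁ y'))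
    ecol-out-preserved y y' out τ̂y≢τ̂y' = begin
      ec (τ̂ D (proj₁ (to f y))) (τ̂ D (proj₁ (to f y')))
        ≡⟨ sym (ecol-τ̂ _ _ (Sum.map (out-preserved y) (out-preserved y') out)) ⟩
      ecol Y (proj₁ (to f y)) (proj₁ (to f y'))
        ≡⟨ to-ecol f y y' (τ̂y≢τ̂y' ∘ cong (τ̂ D ∘ proj₁)) ⟩
      ecol Y (proj₁ y) (proj₁ y')
        ≡⟨ ecol-τ̂ _ _ out ⟩
      ec (τ̂ D (proj₁ y)) (τ̂ D (proj₁ y')) ∎

  onH-inverse : {U U' : V Y → Bool} (f : induced Y U ≅ induced Y U') (g : induced Y U' ≅ induced Y U) →
                (∀ y → to g (to f y) ≡ y) → ∀ u → onH g (onH f u) ≡ u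
  onH-inverse f g g∘f u = proj₁-injective (inj₂-injective (begin
    inj₂ (proj₁ (onH g (onH f u)))
      ≡⟨ sym (to-onH g (onH f u)) ⟩
    proj₁ (to g (inj₂ (proj₁ (onH f u)) , proj₂ (onH f u)))
      ≡⟨ cong (proj₁ ∘ to g) (proj₁-injective (sym (to-onH f u))) ⟩
    proj₁ (to g (to f (inj₂ (proj₁ u) , proj₂ u)))
      ≡⟨ cong proj₁ (g∘f _) ⟩
    inj₂ (proj₁ u) ∎))

  restrictToH : {U U' : V Y → Bool} → induced Y U ≅ induced Y U' →
                induced (raw H) (U ∘ inj₂) ≅ induced (raw H) (U' ∘ inj₂)
  restrictToH f = record
    { to      = onH f
    ; from    = onH (≅-sym f)
    ; from∘to = onH-inverse f (≅-sym f) (from∘to f)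
    ; to∘from = onH-inverse (≅-sym f) f (to∘from f)
    ; to-vcol = λ _ → monochrome D _ _
    ; to-ecol = λ u u' u≢u' →
        trans (cong₂ (ecol Y) (sym (to-onH f u)) (sym (to-onH f u')))
              (to-ecol f _ _ (u≢u' ∘ proj₁-injective ∘ inj₂-injective ∘ cong proj₁))
    }

  AgreesOnH : {U U' : V Y → Bool} → induced Y U ≅ induced Y U' → Aut (raw H) → Set
  AgreesOnH f β = ∀ h p → proj₁ (to f (inj₂ h , p)) ≡ inj₂ (to β h)

  extends⇒agreesOnH : {U U' : V Y → Bool} (f : induced Y U ≅ induced Y U') {β : Aut (raw H)} →
                      Extends (to β) (restrictToH f) → AgreesOnH f β
  extends⇒agreesOnH f β-extends h p = trans (to-onH f (h , p)) (cong inj₂ (sym (β-extends (h , p))))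

  InImage : (V Y → Bool) → V (raw G) → Set
  InImage U v = ∃ λ y → U y ≡ true × τ̂ D y ≡ v

  -- Subsets are Boolean predicates, so τ̂(U) must be decided; this uses the finiteness of G and H.
  inImage? : (U : V Y → Bool) → Decidable (InImage U)
  inImage? U v = map′ (λ { (inj₁ (o , p , e)) → inj₁ o , p , e ; (inj₂ (h , p , e)) → inj₂ h , p , e })
                      (λ { (inj₁ o , p , e) → inj₁ (o , p , e) ; (inj₂ h , p , e) → inj₂ (h , p , e) })
                      (out? ⊎-dec ∃-finite? (enum H) (λ h → (U (inj₂ h) ≟ᵇ true) ×-dec (proj₁ (ρ h) ≟G v)))
    where
    out? : Dec (∃ λ o → U (inj₁ o) ≡ true × proj₁ o ≡ v)
    out? with vcol (raw G) v ≡ᵇ c in q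
    ... | true  = no λ { ((_ , q') , _ , refl) → class≢out (in-class q) q' }
    ... | false = map′ (λ p → (v , q) , p , refl)
                       (λ { ((_ , q') , p , refl) → subst (λ q → U (inj₁ (v , q)) ≡ true) (uip q' q) p })
                       (U (inj₁ (v , q)) ≟ᵇ true)

  image : (V Y → Bool) → V (raw G) → Bool
  image U v = does (inImage? U v)

  image-intro : {U : V Y → Bool} (y : V Y) → U y ≡ true → image U (τ̂ D y) ≡ true
  image-intro y p = witness⇒true (inImage? _ _) (y , p , refl)

  image-full : ∀ v → image full v ≡ true
  image-full v = let (y , τ̂y≡v) = τ̂-surjective v in subst (λ v → image full v ≡ true) τ̂y≡v (image-intro y refl)

  preimage : {U : V Y → Bool} → Sub (raw G) (image U) → Sub Y U
  preimage (v , p) = let (y , py , _) = true⇒witness (inImage? _ v) p in y , py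

  τ̂-preimage : {U : V Y → Bool} (u : Sub (raw G) (image U)) → τ̂ D (proj₁ (preimage u)) ≡ proj₁ u
  τ̂-preimage (v , p) = proj₂ (proj₂ (true⇒witness (inImage? _ v) p))

  module DescendMap {W W' : V Y → Bool} (φ : Sub Y W → Sub Y W') (γ : Aut (raw H))
                    (φ-on-H : ∀ h p → proj₁ (φ (inj₂ h , p)) ≡ inj₂ (to γ h)) where

    respects-τ̂ : ∀ y y' → τ̂ D (proj₁ y) ≡ τ̂ D (proj₁ y') → τ̂ D (proj₁ (φ y)) ≡ τ̂ D (proj₁ (φ y'))
    respects-τ̂ (inj₁ o , p) y' e =
      cong (τ̂ D ∘ proj₁ ∘ φ) (proj₁-injective (τ̂-injective-out (inj₁ (o , refl)) e))
    respects-τ̂ (inj₂ h , p) (inj₁ o , p') e =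
      cong (τ̂ D ∘ proj₁ ∘ φ) (proj₁-injective (τ̂-injective-out (inj₂ (o , refl)) e))
    respects-τ̂ (inj₂ h , p) (inj₂ h' , p') e = begin
      τ̂ D (proj₁ (φ (inj₂ h , p)))   ≡⟨ cong (τ̂ D) (φ-on-H h p) ⟩
      proj₁ (ρ (to γ h))             ≡⟨ cong proj₁ (ρ-preserved γ (proj₁-injective e)) ⟩
      proj₁ (ρ (to γ h'))            ≡⟨ cong (τ̂ D) (sym (φ-on-H h' p')) ⟩
      τ̂ D (proj₁ (φ (inj₂ h' , p'))) ∎

    descendMap : Sub (raw G) (image W) → Sub (raw G) (image W')
    descendMap u = τ̂ D (proj₁ (φ (preimage u))) , image-intro _ (proj₂ (φ (preimage u)))

    descendMap-τ̂ : ∀ y p → proj₁ (descendMap (τ̂ D (proj₁ y) , p)) ≡ τ̂ D (proj₁ (φ y))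
    descendMap-τ̂ y p = respects-τ̂ (preimage (τ̂ D (proj₁ y) , p)) y (τ̂-preimage _)

  module Descend {U U' : V Y → Bool} (f : induced Y U ≅ induced Y U') (β : Aut (raw H))
                 (β-extends : Extends (to β) (restrictToH f)) where

    f-on-H : AgreesOnH f β
    f-on-H = extends⇒agreesOnH f {β} β-extends

    ψ : Aut G[R]
    ψ = proj₁ (push β)

    private
      module Forward = DescendMap (to f) β f-on-H
      module Backward = DescendMap (from f) (≅-sym β)
        (extends⇒agreesOnH (≅-sym f) {≅-sym β} (extends-sym {f = restrictToH f} β β-extends))

    ecol-descends : ∀ y y' → τ̂ D (proj₁ y) ≢ τ̂ D (proj₁ y') →
                    ec (τ̂ D (proj₁ (to f y))) (τ̂ D (proj₁ (to f y'))) ≡ ec (τ̂ D (proj₁ y)) (τ̂ D (proj₁ y'))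
    ecol-descends (inj₁ o , p) y' = ecol-out-preserved f _ y' (inj₁ (o , refl))
    ecol-descends (inj₂ h , p) (inj₁ o , p') = ecol-out-preserved f _ _ (inj₂ (o , refl))
    ecol-descends (inj₂ h , p) (inj₂ h' , p') τ̂y≢τ̂y' = begin
      ec (τ̂ D (proj₁ (to f (inj₂ h , p)))) (τ̂ D (proj₁ (to f (inj₂ h' , p'))))
        ≡⟨ cong₂ (λ y y' → ec (τ̂ D y) (τ̂ D y')) (f-on-H h p) (f-on-H h' p') ⟩
      ec (proj₁ (ρ (to β h))) (proj₁ (ρ (to β h')))
        ≡⟨ cong₂ (λ r r' → ec (proj₁ r) (proj₁ r')) (proj₂ (push β) h) (proj₂ (push β) h') ⟩
      ec (proj₁ (to ψ (ρ h))) (proj₁ (to ψ (ρ h')))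
        ≡⟨ to-ecol ψ (ρ h) (ρ h') (τ̂y≢τ̂y' ∘ cong proj₁) ⟩
      ec (proj₁ (ρ h)) (proj₁ (ρ h')) ∎

    descended : induced (raw G) (image U) ≅ induced (raw G) (image U')
    descended = record
      { to      = Forward.descendMap
      ; from    = Backward.descendMap
      ; from∘to = λ u → proj₁-injective (trans (Backward.descendMap-τ̂ (to f (preimage u)) _)
                                               (trans (cong (τ̂ D ∘ proj₁) (from∘to f _)) (τ̂-preimage u)))
      ; to∘from = λ u → proj₁-injective (trans (Forward.descendMap-τ̂ (from f (preimage u)) _)
                                               (trans (cong (τ̂ D ∘ proj₁) (to∘from f _)) (τ̂-preimage u)))
      ; to-vcol = λ u → trans (to-vcol f (preimage u)) (cong (vcol (raw G)) (τ̂-preimage u))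
      ; to-ecol = λ u u' u≢u' →
          trans (ecol-descends (preimage u) (preimage u') (u≢u' ∘ proj₁-injective ∘ τ̂-preimage-≡ u u'))
                (cong₂ ec (τ̂-preimage u) (τ̂-preimage u'))
      }
      where
      τ̂-preimage-≡ : ∀ u u' → τ̂ D (proj₁ (preimage u)) ≡ τ̂ D (proj₁ (preimage u')) → proj₁ u ≡ proj₁ u'
      τ̂-preimage-≡ u u' e = trans (sym (τ̂-preimage u)) (trans e (τ̂-preimage u'))

    descended-τ̂ : ∀ y p → proj₁ (to descended (τ̂ D (proj₁ y) , p)) ≡ τ̂ D (proj₁ (to f y))
    descended-τ̂ = Forward.descendMap-τ̂

    descended-compatible : Compatible descended ψ
    descended-compatible u e = begin
      proj₁ (to ψ (proj₁ u , e))            ≡⟨ cong (proj₁ ∘ to ψ) (sym ρh≡u) ⟩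
      proj₁ (to ψ (ρ h))                    ≡⟨ cong proj₁ (sym (proj₂ (push β) h)) ⟩
      proj₁ (ρ (to β h))                    ≡⟨ cong (τ̂ D) (sym (f-on-H h p)) ⟩
      τ̂ D (proj₁ (to f (inj₂ h , p)))       ≡⟨ cong (τ̂ D ∘ proj₁ ∘ to f) (proj₁-injective (sym y≡h)) ⟩
      τ̂ D (proj₁ (to f (preimage u)))       ∎
      where
      y = preimage u
      y-in-H = vcol≡c⇒inj₂ (proj₁ y) (trans (cong (vcol (raw G)) (τ̂-preimage u)) e)
      h = proj₁ y-in-H
      y≡h : proj₁ y ≡ inj₂ h
      y≡h = proj₂ y-in-H
      p : U (inj₂ h) ≡ true
      p = subst (λ y → U y ≡ true) y≡h (proj₂ y)
      ρh≡u : ρ h ≡ (proj₁ u , e)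
      ρh≡u = proj₁-injective (trans (cong (τ̂ D) (sym y≡h)) (τ̂-preimage u))

  module LiftMap {U U' : V (raw G) → Bool} (f : induced (raw G) U ≅ induced (raw G) U') (ψ : Aut G[R])
                 (η : Aut (raw H)) (compatible : Compatible f ψ) (η-covers : η Covers ψ) where

    ρ∘η : ∀ h p → proj₁ (ρ (to η h)) ≡ proj₁ (to f (proj₁ (ρ h) , p))
    ρ∘η h p = trans (cong proj₁ (η-covers h)) (compatible (proj₁ (ρ h) , p) (proj₂ (ρ h)))

    liftMap : Sub Y (U ∘ τ̂ D) → Sub Y (U' ∘ τ̂ D)
    liftMap (inj₁ (v , q) , p) =
      inj₁ (proj₁ (to f (v , p)) , trans (cong (_≡ᵇ c) (to-vcol f (v , p))) q) , proj₂ (to f (v , p))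
    liftMap (inj₂ h , p) =
      inj₂ (to η h) , subst (λ v → U' v ≡ true) (sym (ρ∘η h p)) (proj₂ (to f (proj₁ (ρ h) , p)))

    liftMap-τ̂ : ∀ y → τ̂ D (proj₁ (liftMap y)) ≡ proj₁ (to f (τ̂ D (proj₁ y) , proj₂ y))
    liftMap-τ̂ (inj₁ _ , _) = refl
    liftMap-τ̂ (inj₂ h , p) = ρ∘η h p

    liftMap-out : ∀ y → IsOut (proj₁ y) → IsOut (proj₁ (liftMap y))
    liftMap-out (inj₁ _ , _) _ = _ , refl

    ecol-out-lifts : ∀ y y' → IsOut (proj₁ y) ⊎ IsOut (proj₁ y') → y ≢ y' →
                     ecol Y (proj₁ (liftMap y)) (proj₁ (liftMap y')) ≡ ecol Y (proj₁ y) (proj₁ y')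
    ecol-out-lifts y y' out y≢y' = begin
      ecol Y (proj₁ (liftMap y)) (proj₁ (liftMap y'))
        ≡⟨ ecol-τ̂ _ _ (Sum.map (liftMap-out y) (liftMap-out y') out) ⟩
      ec (τ̂ D (proj₁ (liftMap y))) (τ̂ D (proj₁ (liftMap y')))
        ≡⟨ cong₂ ec (liftMap-τ̂ y) (liftMap-τ̂ y') ⟩
      ec (proj₁ (to f (τ̂ D (proj₁ y) , proj₂ y))) (proj₁ (to f (τ̂ D (proj₁ y') , proj₂ y')))
        ≡⟨ to-ecol f _ _ (y≢y' ∘ proj₁-injective ∘ τ̂-injective-out out ∘ cong proj₁) ⟩
      ec (τ̂ D (proj₁ y)) (τ̂ D (proj₁ y'))
        ≡⟨ sym (ecol-τ̂ _ _ out) ⟩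
      ecol Y (proj₁ y) (proj₁ y') ∎

    ecol-lifts : ∀ y y' → y ≢ y' →
                 ecol Y (proj₁ (liftMap y)) (proj₁ (liftMap y')) ≡ ecol Y (proj₁ y) (proj₁ y')
    ecol-lifts (inj₂ h , p) (inj₂ h' , p') y≢y' = to-ecol η h h' (y≢y' ∘ proj₁-injective ∘ cong inj₂)
    ecol-lifts (inj₁ o , p) y' = ecol-out-lifts _ y' (inj₁ (o , refl))
    ecol-lifts (inj₂ h , p) (inj₁ o , p') = ecol-out-lifts _ _ (inj₂ (o , refl))

  module Lift {U U' : V (raw G) → Bool} (f : induced (raw G) U ≅ induced (raw G) U') (ψ : Aut G[R])
              (η : Aut (raw H)) (compatible : Compatible f ψ) (η-covers : η Covers ψ) where

    private
      module Forward = LiftMap f ψ η compatible η-covers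
      module Backward = LiftMap (≅-sym f) (≅-sym ψ) (≅-sym η)
                                (compatible-sym {f = f} {ψ} compatible) (covers-sym {η} {ψ} η-covers)

    lifted : induced Y (U ∘ τ̂ D) ≅ induced Y (U' ∘ τ̂ D)
    lifted = record
      { to      = Forward.liftMap
      ; from    = Backward.liftMap
      ; from∘to = λ { (inj₁ (v , _) , p) → out-≡ (cong proj₁ (from∘to f (v , p)))
                    ; (inj₂ h , _)       → proj₁-injective (cong inj₂ (from∘to η h)) }
      ; to∘from = λ { (inj₁ (v , _) , p) → out-≡ (cong proj₁ (to∘from f (v , p)))
                    ; (inj₂ h , _)       → proj₁-injective (cong inj₂ (to∘from η h)) }
      ; to-vcol = λ y → trans (cong (vcol (raw G)) (Forward.liftMap-τ̂ y)) (to-vcol f _)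
      ; to-ecol = Forward.ecol-lifts
      }

    lifted-τ̂ : ∀ y → τ̂ D (proj₁ (to lifted y)) ≡ proj₁ (to f (τ̂ D (proj₁ y) , proj₂ y))
    lifted-τ̂ = Forward.liftMap-τ̂

  project : (α : Aut Y) → Σ (Aut (raw G)) λ σ → τ̂ D ∘ to α ≗ to σ ∘ τ̂ D
  project α = full⇒Aut image-full image-full descended , λ y → sym (descended-τ̂ (y , refl) _)
    where
    αᶠ = Aut⇒full α
    β = full⇒Aut (λ _ → refl) (λ _ → refl) (restrictToH αᶠ)
    open Descend αᶠ β (full⇒Aut-extends (λ _ → refl) (λ _ → refl) (restrictToH αᶠ))

  liftAut : (σ : Aut (raw G)) (η : Aut (raw H)) → η Covers restrictToClass σ →
            Σ (Aut Y) λ α → τ̂ D ∘ to α ≗ to σ ∘ τ̂ D × (∀ h → to α (inj₂ h) ≡ inj₂ (to η h))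
  liftAut σ η η-covers =
    full⇒Aut (λ _ → refl) (λ _ → refl) lifted , (λ y → lifted-τ̂ (y , refl)) , λ _ → refl
    where open Lift (Aut⇒full σ) (restrictToClass σ) η (λ _ _ → refl) η-covers

  meets? : (P : V (raw H) → Bool) → Decidable (λ X → ∃ λ h → P h ≡ true × blk D h ≡ X)
  meets? P X = ∃-finite? (enum H) (λ h → (P h ≟ᵇ true) ×-dec (blk D h ≟B X))

  -- For a lift ψ̂ of ψ, β⁻¹ ∘ ψ̂ fixes every block met by P, so easygoingness induces its block
  -- permutation by some γ fixing those blocks pointwise; β ∘ γ still lifts ψ and agrees with β on P.
  liftAgreeing : Easygoing D → (β : Aut (raw H)) (ψ : Aut G[R]) (P : V (raw H) → Bool) →
                 (∀ h → P h ≡ true → to ψ (ρ h) ≡ ρ (to β h)) →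
                 Σ (Aut (raw H)) λ η → η Covers ψ × (∀ h → P h ≡ true → to η h ≡ to β h)
  liftAgreeing easygoing β ψ P agree = ≅-trans γ β , covers , agrees
    where
    ψ̂ = proj₁ (pull ψ)
    δ = ≅-trans ψ̂ (≅-sym β)
    π = proj₁ (blockPermutation δ)
    met : B D → Bool
    met X = does (meets? P X)

    ψ̂-agrees-on-blocks : ∀ h → P h ≡ true → blk D (to ψ̂ h) ≡ blk D (to β h)
    ψ̂-agrees-on-blocks h Ph = τ-injective (trans (proj₂ (pull ψ) h) (agree h Ph))

    π-fixes-met : ∀ X → met X ≡ true → π X ≡ X
    π-fixes-met X met-X with true⇒witness (meets? P X) met-X
    ... | h , Ph , refl = begin
      π (blk D h)                      ≡⟨ proj₂ (blockPermutation δ) h ⟩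
      blk D (from β (to ψ̂ h))          ≡⟨ blk-preserved (≅-sym β) (ψ̂-agrees-on-blocks h Ph) ⟩
      blk D (from β (to β h))          ≡⟨ cong (blk D) (from∘to β h) ⟩
      blk D h                          ∎

    γ-data = Equivalence.from (easygoing met π) ((to δ , isIso δ , proj₂ (blockPermutation δ)) , π-fixes-met)
    γ = fromIsIso (proj₁ (proj₂ γ-data))
    γ-fixes-met = proj₁ (proj₂ (proj₂ γ-data))
    γ-induces-π = proj₂ (proj₂ (proj₂ γ-data))

    covers : ≅-trans γ β Covers ψ
    covers h = begin
      ρ (to β (to γ h))         ≡⟨ ρ-preserved β (cong (τ D) (trans (sym (γ-induces-π h))
                                                                   (proj₂ (blockPermutation δ) h))) ⟩
      ρ (to β (to δ h))         ≡⟨ cong ρ (to∘from β (to ψ̂ h)) ⟩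
      ρ (to ψ̂ h)                ≡⟨ proj₂ (pull ψ) h ⟩
      to ψ (ρ h)                ∎

    agrees : ∀ h → P h ≡ true → to β (to γ h) ≡ to β h
    agrees h Ph = cong (to β) (γ-fixes-met h (witness⇒true (meets? P (blk D h)) (h , Ph , refl)))

  blowUp-ultrahomogeneous⇒classUltrahomogeneous : Ultrahomogeneous Y → ClassUltrahomogeneous
  blowUp-ultrahomogeneous⇒classUltrahomogeneous uhY {U} f ψ compatible = σ , σ-extends
    where
    η = pull ψ
    open Lift f ψ (proj₁ η) compatible (proj₂ η)
    α = extend uhY lifted
    σ = proj₁ (project (proj₁ α))

    σ-extends : Extends (to σ) f
    σ-extends (v , p) = let (y , τ̂y≡v) = τ̂-surjective v
                            p' = subst (λ v → U v ≡ true) (sym τ̂y≡v) p in begin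
      to σ v                                  ≡⟨ cong (to σ) (sym τ̂y≡v) ⟩
      to σ (τ̂ D y)                            ≡⟨ sym (proj₂ (project (proj₁ α)) y) ⟩
      τ̂ D (to (proj₁ α) y)                    ≡⟨ cong (τ̂ D) (proj₂ α (y , p')) ⟩
      τ̂ D (proj₁ (to lifted (y , p')))        ≡⟨ lifted-τ̂ (y , p') ⟩
      proj₁ (to f (τ̂ D y , p'))               ≡⟨ cong (proj₁ ∘ to f) (proj₁-injective τ̂y≡v) ⟩
      proj₁ (to f (v , p))                    ∎

  classUltrahomogeneous⇒blowUp-ultrahomogeneous :
    Ultrahomogeneous (raw H) → Easygoing D → ClassUltrahomogeneous → Ultrahomogeneous Y
  classUltrahomogeneous⇒blowUp-ultrahomogeneous uhH easygoing classUH = ultrahomogeneous extendY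
    where
    extendY : ∀ {U U'} (f : induced Y U ≅ induced Y U') → Σ (Aut Y) λ α → Extends (to α) f
    extendY {U} f = proj₁ A , A-extends
      where
      β = extend uhH (restrictToH f)
      open Descend f (proj₁ β) (proj₂ β)
      σ = classUH descended ψ descended-compatible

      σ-descends : ∀ y (p : U y ≡ true) → to (proj₁ σ) (τ̂ D y) ≡ τ̂ D (proj₁ (to f (y , p)))
      σ-descends y p = trans (proj₂ σ (τ̂ D y , image-intro y p)) (descended-τ̂ (y , p) _)

      η = liftAgreeing easygoing (proj₁ β) (restrictToClass (proj₁ σ)) (U ∘ inj₂)
            (λ h p → proj₁-injective (trans (σ-descends (inj₂ h) p) (cong (τ̂ D) (f-on-H h p))))
      A = liftAut (proj₁ σ) (proj₁ η) (proj₁ (proj₂ η))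

      A-extends : Extends (to (proj₁ A)) f
      A-extends (inj₁ o , p) = τ̂-injective-out (inj₁ (_ , refl))
        (trans (proj₁ (proj₂ A) (inj₁ o)) (σ-descends (inj₁ o) p))
      A-extends (inj₂ h , p) = begin
        to (proj₁ A) (inj₂ h)             ≡⟨ proj₂ (proj₂ A) h ⟩
        inj₂ (to (proj₁ η) h)             ≡⟨ cong inj₂ (proj₂ (proj₂ η) h p) ⟩
        inj₂ (to (proj₁ β) h)             ≡⟨ sym (f-on-H h p) ⟩
        proj₁ (to f (inj₂ h , p))         ∎

  blowUp-ultrahomogeneous⇔classUltrahomogeneous :
    Ultrahomogeneous (raw H) → Easygoing D → Ultrahomogeneous Y ⇔ ClassUltrahomogeneous
  blowUp-ultrahomogeneous⇔classUltrahomogeneous uhH easygoing =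
    mk⇔ blowUp-ultrahomogeneous⇒classUltrahomogeneous
        (classUltrahomogeneous⇒blowUp-ultrahomogeneous uhH easygoing)

mainTheorem8 : (G : CCD) (c : ℕ) → IsColorClass G c →
    (H₁ H₂ : CCD) → Ultrahomogeneous (raw H₁) → Ultrahomogeneous (raw H₂) →
    (D₁ : BlowUpData G c H₁) (D₂ : BlowUpData G c H₂) →
    Easygoing D₁ → Easygoing D₂ →
    (Ultrahomogeneous (blowUp D₁) ⇔ Ultrahomogeneous (blowUp D₂))
    × (Ultrahomogeneous (inducedClass G c) →
    (Ultrahomogeneous (blowUp D₂) ⇔ Ultrahomogeneous (raw G)))
mainTheorem8 G c _ H₁ H₂ uh₁ uh₂ D₁ D₂ easygoing₁ easygoing₂ =
  ⇔.trans Y₁⇔class (⇔.sym Y₂⇔class) ,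
  λ uhR → ⇔.trans Y₂⇔class (⇔.sym (ColorClass.ultrahomogeneous⇔classUltrahomogeneous G c uhR))
  where
  Y₁⇔class = BlowUp.blowUp-ultrahomogeneous⇔classUltrahomogeneous D₁ uh₁ easygoing₁
  Y₂⇔class = BlowUp.blowUp-ultrahomogeneous⇔classUltrahomogeneous D₂ uh₂ easygoing₂
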